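{- For every positive integer $N$ there exists a finite poset $P$ with $\chi_D(G_P)-\chi_D(P)\ge N$; that is, the gap between $\chi_D(P)$ and $\chi_D(G_P)$ can be arbitrarily large.
   Context: For a poset $P$, a coloring is proper if comparable points receive different colors; it is distinguishing if the only color-preserving automorphism of $P$ is the identity. $\chi_D(P)$ is the least $k$ for which $P$ has a proper distinguishing coloring with $k$ colors. The comparability graph $G_P$ has the points of $P$ as vertices, with $x,y$ adjacent iff they are comparable. For a graph $G$, $\chi_D(G)$ is the least number of colors in a proper vertex coloring (adjacent vertices get different colors) whose only color-preserving graph automorphism is the identity. -}

module Defs where

open import Level using (0ℓ)
open import Data.Nat using (ℕ; _≤_)
open import Data.Fin using (Fin)
open import Data.Product using (Σ; _×_)
open import Data.Sum using (_⊎_)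
open import Relation.Binary using (Rel; IsPartialOrder)
open import Relation.Binary.PropositionalEquality using (_≡_)
open import Relation.Nullary using (¬_)
open import Function.Definitions using (Bijective)

record FinPoset : Set₁ where
  field
    size    : ℕ
    _≼_     : Rel (Fin size) 0ℓ
    isPO    : IsPartialOrder _≡_ _≼_

record FinGraph : Set₁ where
  field
    size : ℕ
    Adj  : Rel (Fin size) 0ℓ

comparabilityGraph : FinPoset → FinGraph
comparabilityGraph P = record
  { size = FinPoset.size P
  ; Adj  = λ x y → ¬ (x ≡ y) × (x ≼ y ⊎ y ≼ x) }
  where open FinPoset P

module _ (P : FinPoset) where
  open FinPoset P

  Comparable : Fin size → Fin size → Set
  Comparable x y = x ≼ y ⊎ y ≼ x

  IsPosetAut : (Fin size → Fin size) → Set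
  IsPosetAut σ = Bijective _≡_ _≡_ σ
               × (∀ x y → x ≼ y → σ x ≼ σ y)
               × (∀ x y → σ x ≼ σ y → x ≼ y)

  IsProperPosetColoring : ∀ {k} → (Fin size → Fin k) → Set
  IsProperPosetColoring c = ∀ x y → ¬ (x ≡ y) → Comparable x y → ¬ (c x ≡ c y)

  IsDistinguishingPoset : ∀ {k} → (Fin size → Fin k) → Set
  IsDistinguishingPoset c = ∀ σ → IsPosetAut σ → (∀ x → c (σ x) ≡ c x) → ∀ x → σ x ≡ x

  HasPDColoringPoset : ℕ → Set
  HasPDColoringPoset k = Σ (Fin size → Fin k) λ c → IsProperPosetColoring c × IsDistinguishingPoset c

  IsChiDPoset : ℕ → Set
  IsChiDPoset d = HasPDColoringPoset d × (∀ k → HasPDColoringPoset k → d ≤ k)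

module _ (G : FinGraph) where
  open FinGraph G

  IsGraphAut : (Fin size → Fin size) → Set
  IsGraphAut σ = Bijective _≡_ _≡_ σ
               × (∀ x y → Adj x y → Adj (σ x) (σ y))
               × (∀ x y → Adj (σ x) (σ y) → Adj x y)

  IsProperGraphColoring : ∀ {k} → (Fin size → Fin k) → Set
  IsProperGraphColoring c = ∀ x y → Adj x y → ¬ (c x ≡ c y)

  IsDistinguishingGraph : ∀ {k} → (Fin size → Fin k) → Set
  IsDistinguishingGraph c = ∀ σ → IsGraphAut σ → (∀ x → c (σ x) ≡ c x) → ∀ x → σ x ≡ x

  HasPDColoringGraph : ℕ → Set
  HasPDColoringGraph k = Σ (Fin size → Fin k) λ c → IsProperGraphColoring c × IsDistinguishingGraph c

  IsChiDGraph : ℕ → Set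
  IsChiDGraph d = HasPDColoringGraph d × (∀ k → HasPDColoringGraph k → d ≤ k)

module Submission where

-- Witness: the poset M of n = K² disjoint two-element chains, with K = 3N.
--  * Poset side: K + 1 colours suffice.  Code chain i by a pair (p, q) of elements of
--    Fin K, colour its bottom p and its top q (re-indexed to avoid p).  Automorphisms of M
--    map chains to chains preserving levels, so a colour-preserving one fixes each chain.
--  * Graph side: G_M is a perfect matching, and exchanging two edges (flipping them if
--    needed) is an automorphism.  Hence in a distinguishing colouring with J colours the
--    pairs (colour of x, colour of its neighbour) are pairwise distinct: 2K² ≤ J².
--    With K = 3N this forces J ≥ 4N + 1 ≥ χ_D(M) + N.
-- Since χ_D is defined as a least element, we first show it exists for any finite poset
-- with decidable order (and its comparability graph): proper distinguishing colourability
-- with k colours is decidable by exhaustive search over the finite function spaces, and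
-- the least number principle then applies.

open import Defs
open import Data.Nat using (ℕ; _≤_; _+_)
open import Data.Product using (Σ; _×_)

open import Level using (0ℓ)
open import Data.Nat using (zero; suc; _<_; _*_; s≤s)
open import Data.Nat.Properties
  using (≤-refl; ≤-trans; ≤-antisym; ≮⇒≥; <-irrefl; ≤-<-trans; *-mono-≤; +-monoˡ-≤; m≤m+n; m<m+n;
         anyUpTo?; module ≤-Reasoning)
open import Data.Nat.Solver using (module +-*-Solver)
open import Data.Bool using (Bool; true; false; not; _xor_)
open import Data.Bool.Properties
  using (¬-not; xor-assoc; xor-same; xor-comm; xor-identityʳ; not-distribˡ-xor)
  renaming (_≟_ to _≟ᵇ_)
open import Data.Fin using (Fin; zero; suc; splitAt; join; _↑ˡ_; _↑ʳ_; inject₁; punchIn; remQuot; combine)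
open import Data.Fin.Properties
  using (_≟_; all?; any?; splitAt-↑ˡ; splitAt-↑ʳ; join-splitAt; combine-remQuot;
         inject₁-injective; punchIn-injective; punchInᵢ≢i; combine-injective; injective⇒≤)
open import Data.Product using (∃; _,_; proj₁; proj₂; uncurry)
open import Data.Sum using (_⊎_; inj₁; inj₂; [_,_]′)
open import Data.Empty using (⊥-elim)
open import Function using (_∘_; id)
open import Function.Definitions using (Bijective; Injective; Surjective)
open import Relation.Binary using (Rel; Decidable)
open import Relation.Binary.PropositionalEquality
  using (_≡_; _≢_; refl; sym; trans; cong; cong₂; subst; subst₂; isEquivalence; module ≡-Reasoning)
open import Relation.Nullary using (¬_; Dec; yes; no)
open import Relation.Nullary.Decidable using (map′; _×-dec_; _→-dec_; _⊎-dec_; ¬?)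

Extensional : ∀ {n k} → ((Fin n → Fin k) → Set) → Set
Extensional P = ∀ f g → (∀ x → f x ≡ g x) → P f → P g

_◂_ : ∀ {n k} → Fin k → (Fin n → Fin k) → Fin (suc n) → Fin k
(a ◂ g) zero    = a
(a ◂ g) (suc x) = g x

◂-η : ∀ {n k} (f : Fin (suc n) → Fin k) (x : Fin (suc n)) → (f zero ◂ (f ∘ suc)) x ≡ f x
◂-η f zero    = refl
◂-η f (suc x) = refl

◂-extensional : ∀ {n k} {P : (Fin (suc n) → Fin k) → Set} →
                Extensional P → ∀ a → Extensional (λ g → P (a ◂ g))
◂-extensional ext a f g f≗g = ext (a ◂ f) (a ◂ g) λ { zero → refl ; (suc x) → f≗g x }

empty : ∀ {k} → Fin 0 → Fin k
empty ()

∀-fun? : ∀ n {k} {P : (Fin n → Fin k) → Set} →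
         Extensional P → (∀ f → Dec (P f)) → Dec (∀ f → P f)
∀-fun? zero    ext P? = map′ (λ p f → ext empty f (λ ()) p) (λ h → h empty) (P? empty)
∀-fun? (suc n) ext P? =
  map′ (λ h f → ext _ f (◂-η f) (h (f zero) (f ∘ suc))) (λ h a g → h (a ◂ g))
       (all? λ a → ∀-fun? n (◂-extensional ext a) (λ g → P? (a ◂ g)))

∃-fun? : ∀ n {k} {P : (Fin n → Fin k) → Set} →
         Extensional P → (∀ f → Dec (P f)) → Dec (Σ (Fin n → Fin k) P)
∃-fun? zero    ext P? = map′ (λ p → empty , p) (λ (f , p) → ext f empty (λ ()) p) (P? empty)
∃-fun? (suc n) ext P? =
  map′ (λ (a , g , p) → a ◂ g , p)
       (λ (f , p) → f zero , f ∘ suc , ext f _ (λ x → sym (◂-η f x)) p)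
       (any? λ a → ∃-fun? n (◂-extensional ext a) (λ g → P? (a ◂ g)))

IsLeast : (ℕ → Set) → ℕ → Set
IsLeast H d = H d × (∀ k → H k → d ≤ k)

module _ {H : ℕ → Set} (H? : ∀ k → Dec (H k)) where

  least-below : ∀ v → (∃ λ m → m < v × H m) → ∃ (IsLeast H)
  least-below (suc v) (m , s≤s m≤v , Hm) with anyUpTo? H? v
  ... | yes smaller = least-below v smaller
  ... | no  none    = v , subst H m≡v Hm , λ k Hk → ≮⇒≥ λ k<v → none (k , k<v , Hk)
    where
    m≡v : m ≡ v
    m≡v = ≤-antisym m≤v (≮⇒≥ λ m<v → none (m , m<v , Hm))

  least : ∀ m → H m → ∃ (IsLeast H)
  least m Hm = least-below (suc m) (m , ≤-refl , Hm)

-- Automorphisms and distinguishing colourings of a decidable binary relation R on Fin s.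
-- Both posets (R = ≼) and graphs (R = adjacency) are instances.
module Colourings {s : ℕ} (R : Rel (Fin s) 0ℓ) (R? : Decidable R) where

  IsAut : (Fin s → Fin s) → Set
  IsAut σ = Bijective _≡_ _≡_ σ
          × (∀ x y → R x y → R (σ x) (σ y))
          × (∀ x y → R (σ x) (σ y) → R x y)

  IsDistinguishing : ∀ {k} → (Fin s → Fin k) → Set
  IsDistinguishing c = ∀ σ → IsAut σ → (∀ x → c (σ x) ≡ c x) → ∀ x → σ x ≡ x

  injective? : (σ : Fin s → Fin s) → Dec (Injective _≡_ _≡_ σ)
  injective? σ = map′ (λ h {x} {y} → h x y) (λ h x y → h {x} {y})
                      (all? λ x → all? λ y → (σ x ≟ σ y) →-dec (x ≟ y))

  surjective? : (σ : Fin s → Fin s) → Dec (Surjective _≡_ _≡_ σ)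
  surjective? σ = map′ (λ h y → proj₁ (h y) , λ { refl → proj₂ (h y) })
                       (λ h y → proj₁ (h y) , proj₂ (h y) refl)
                       (all? λ y → any? λ x → σ x ≟ y)

  aut? : (σ : Fin s → Fin s) → Dec (IsAut σ)
  aut? σ = (injective? σ ×-dec surjective? σ)
     ×-dec ((all? λ x → all? λ y → R? x y →-dec R? (σ x) (σ y))
     ×-dec  (all? λ x → all? λ y → R? (σ x) (σ y) →-dec R? x y))

  aut-extensional : Extensional IsAut
  aut-extensional σ τ σ≗τ ((inj , surj) , pres , refl′) =
      ( (λ {x} {y} e → inj (trans (σ≗τ x) (trans e (sym (σ≗τ y)))))
      , (λ y → proj₁ (surj y) , λ {z} z≡ → trans (sym (σ≗τ z)) (proj₂ (surj y) z≡)))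
    , (λ x y r → subst₂ R (σ≗τ x) (σ≗τ y) (pres x y r))
    , (λ x y r → refl′ x y (subst₂ R (sym (σ≗τ x)) (sym (σ≗τ y)) r))

  distinguishing? : ∀ {k} (c : Fin s → Fin k) → Dec (IsDistinguishing c)
  distinguishing? c = ∀-fun? s extensional body?
    where
    Body : (Fin s → Fin s) → Set
    Body σ = IsAut σ → (∀ x → c (σ x) ≡ c x) → ∀ x → σ x ≡ x
    extensional : Extensional Body
    extensional σ τ σ≗τ h aut pres x =
      trans (sym (σ≗τ x))
            (h (aut-extensional τ σ (sym ∘ σ≗τ) aut) (λ y → trans (cong c (σ≗τ y)) (pres y)) x)
    body? : ∀ σ → Dec (Body σ)
    body? σ = aut? σ →-dec ((all? λ x → c (σ x) ≟ c x) →-dec (all? λ x → σ x ≟ x))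

  distinguishing-extensional : ∀ {k} → Extensional (IsDistinguishing {k})
  distinguishing-extensional c d c≗d h σ aut pres =
    h σ aut (λ x → trans (c≗d (σ x)) (trans (pres x) (sym (c≗d x))))

  module _ (Proper : ∀ {k} → (Fin s → Fin k) → Set)
           (proper? : ∀ {k} (c : Fin s → Fin k) → Dec (Proper c))
           (proper-extensional : ∀ {k} → Extensional (Proper {k})) where

    HasColouring : ℕ → Set
    HasColouring k = Σ (Fin s → Fin k) λ c → Proper c × IsDistinguishing c

    hasColouring? : ∀ k → Dec (HasColouring k)
    hasColouring? k = ∃-fun? s
      (λ c d c≗d (p , δ) → proper-extensional c d c≗d p , distinguishing-extensional c d c≗d δ)
      (λ c → proper? c ×-dec distinguishing? c)

    chromatic-exists : ∀ k → HasColouring k → ∃ (IsLeast HasColouring)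
    chromatic-exists = least hasColouring?

chiD-poset : (P : FinPoset) → Decidable (FinPoset._≼_ P) →
             ∀ k → HasPDColoringPoset P k → ∃ (IsChiDPoset P)
chiD-poset P _≼?_ = chromatic-exists (IsProperPosetColoring P) proper? proper-extensional
  where
  open FinPoset P using (_≼_)
  open Colourings _≼_ _≼?_
  proper? : ∀ {k} (c : Fin (FinPoset.size P) → Fin k) → Dec (IsProperPosetColoring P c)
  proper? c = all? λ x → all? λ y →
    ¬? (x ≟ y) →-dec ((x ≼? y ⊎-dec y ≼? x) →-dec ¬? (c x ≟ c y))
  proper-extensional : ∀ {k} → Extensional (IsProperPosetColoring P {k})
  proper-extensional c d c≗d h x y x≢y cmp e = h x y x≢y cmp (trans (c≗d x) (trans e (sym (c≗d y))))

-- χ_D(G_P) exists for every finite poset with decidable order: the identity colouring,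
-- which gives every point its own colour, is proper and distinguishing.
chiD-comparability : (P : FinPoset) → Decidable (FinPoset._≼_ P) →
                     ∃ (IsChiDGraph (comparabilityGraph P))
chiD-comparability P _≼?_ =
  chromatic-exists (IsProperGraphColoring G) proper? proper-extensional
                   (FinGraph.size G) identity-colouring
  where
  G : FinGraph
  G = comparabilityGraph P
  open FinPoset P using (_≼_)
  adj? : Decidable (FinGraph.Adj G)
  adj? x y = ¬? (x ≟ y) ×-dec (x ≼? y ⊎-dec y ≼? x)
  open Colourings (FinGraph.Adj G) adj?
  proper? : ∀ {k} (c : Fin (FinGraph.size G) → Fin k) → Dec (IsProperGraphColoring G c)
  proper? c = all? λ x → all? λ y → adj? x y →-dec ¬? (c x ≟ c y)
  proper-extensional : ∀ {k} → Extensional (IsProperGraphColoring G {k})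
  proper-extensional c d c≗d h x y adj e = h x y adj (trans (c≗d x) (trans e (sym (c≗d y))))
  identity-colouring : HasPDColoringGraph G (FinGraph.size G)
  identity-colouring = (λ x → x) , (λ x y (x≢y , _) → x≢y) , (λ σ _ pres → pres)

-- The poset of n disjoint two-element chains, on the carrier Fin (n + n).
-- A point is determined by its level (false = bottom, true = top) and its chain.
module TwoChains (n : ℕ) where

  point : Bool → Fin n → Fin (n + n)
  point false i = i ↑ˡ n
  point true  i = n ↑ʳ i

  level : Fin (n + n) → Bool
  level x = [ (λ _ → false) , (λ _ → true) ]′ (splitAt n x)

  chain : Fin (n + n) → Fin n
  chain x = [ id , id ]′ (splitAt n x)

  level-point : ∀ l i → level (point l i) ≡ l
  level-point false i rewrite splitAt-↑ˡ n i n = refl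
  level-point true  i rewrite splitAt-↑ʳ n n i = refl

  chain-point : ∀ l i → chain (point l i) ≡ i
  chain-point false i rewrite splitAt-↑ˡ n i n = refl
  chain-point true  i rewrite splitAt-↑ʳ n n i = refl

  point-level-chain : ∀ x → point (level x) (chain x) ≡ x
  point-level-chain x with splitAt n x in eq
  ... | inj₁ i = trans (cong (join n n) (sym eq)) (join-splitAt n n x)
  ... | inj₂ i = trans (cong (join n n) (sym eq)) (join-splitAt n n x)

  point-ext : ∀ {x y} → level x ≡ level y → chain x ≡ chain y → x ≡ y
  point-ext {x} {y} l≡ c≡ =
    trans (sym (point-level-chain x)) (trans (cong₂ point l≡ c≡) (point-level-chain y))

  false≢true : false ≢ true
  false≢true ()

  Covers : Rel (Fin (n + n)) 0ℓ
  Covers x y = level x ≡ false × level y ≡ true × chain x ≡ chain y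

  _≼_ : Rel (Fin (n + n)) 0ℓ
  x ≼ y = x ≡ y ⊎ Covers x y

  -- Two covers never compose: the middle point would be both a top and a bottom.
  no-cover-chain : ∀ {x y z} → Covers x y → ¬ Covers y z
  no-cover-chain (_ , top , _) (bottom , _) = false≢true (trans (sym bottom) top)

  ≼-trans : ∀ {x y z} → x ≼ y → y ≼ z → x ≼ z
  ≼-trans (inj₁ refl) y≼z         = y≼z
  ≼-trans (inj₂ xy)   (inj₁ refl) = inj₂ xy
  ≼-trans (inj₂ xy)   (inj₂ yz)   = ⊥-elim (no-cover-chain xy yz)

  ≼-antisym : ∀ {x y} → x ≼ y → y ≼ x → x ≡ y
  ≼-antisym (inj₁ x≡y) _          = x≡y
  ≼-antisym (inj₂ _)   (inj₁ y≡x) = sym y≡x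
  ≼-antisym (inj₂ xy)  (inj₂ yx)  = ⊥-elim (no-cover-chain xy yx)

  _≼?_ : Decidable _≼_
  x ≼? y = (x ≟ y) ⊎-dec ((level x ≟ᵇ false) ×-dec ((level y ≟ᵇ true) ×-dec (chain x ≟ chain y)))

  M : FinPoset
  M = record
    { size  = n + n
    ; _≼_   = _≼_
    ; isPO  = record
      { isPreorder = record { isEquivalence = isEquivalence ; reflexive = inj₁ ; trans = ≼-trans }
      ; antisym    = ≼-antisym } }

  G : FinGraph
  G = comparabilityGraph M

  strict⇒covers : ∀ {x y} → x ≢ y → x ≼ y → Covers x y
  strict⇒covers x≢y (inj₁ x≡y) = ⊥-elim (x≢y x≡y)
  strict⇒covers x≢y (inj₂ xy)  = xy

  Partner : Rel (Fin (n + n)) 0ℓ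
  Partner x y = chain x ≡ chain y × level x ≢ level y

  adj⇒partner : ∀ {x y} → FinGraph.Adj G x y → Partner x y
  adj⇒partner (x≢y , inj₁ x≼y) with strict⇒covers x≢y x≼y
  ... | bottom , top , c≡ = c≡ , λ l≡ → false≢true (trans (sym bottom) (trans l≡ top))
  adj⇒partner (x≢y , inj₂ y≼x) with strict⇒covers (x≢y ∘ sym) y≼x
  ... | bottom , top , c≡ = sym c≡ , λ l≡ → false≢true (trans (sym bottom) (trans (sym l≡) top))

  partner⇒adj : ∀ {x y} → Partner x y → FinGraph.Adj G x y
  partner⇒adj {x} {y} (c≡ , l≢) = (λ { refl → l≢ refl }) , comparable (level x) (level y) refl refl l≢
    where
    comparable : ∀ lx ly → level x ≡ lx → level y ≡ ly → lx ≢ ly → x ≼ y ⊎ y ≼ x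
    comparable false true  ex ey _ = inj₁ (inj₂ (ex , ey , c≡))
    comparable true  false ex ey _ = inj₂ (inj₂ (ey , ex , sym c≡))
    comparable false false _  _  l≢ = ⊥-elim (l≢ refl)
    comparable true  true  _  _  l≢ = ⊥-elim (l≢ refl)

  opposite : Fin (n + n) → Fin (n + n)
  opposite x = point (not (level x)) (chain x)

-- For n = K * K chains, K + 1 colours suffice for a proper distinguishing colouring of M:
-- chain i, coded by a pair (p , q) ∈ Fin K × Fin K, gets bottom colour p and top colour
-- q punched in around p.  Automorphisms of M map chains to chains preserving levels,
-- and a colour-preserving one must keep every chain because the colour pair encodes it.
module ChainColouring (K : ℕ) where
  open TwoChains (K * K)

  code : Fin (K * K) → Fin K × Fin K
  code = remQuot K

  code-injective : ∀ {i j} → code i ≡ code j → i ≡ j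
  code-injective {i} {j} e =
    trans (sym (combine-remQuot {K} K i)) (trans (cong (uncurry combine) e) (combine-remQuot {K} K j))

  colourAt : Bool → Fin (K * K) → Fin (suc K)
  colourAt false i = inject₁ (proj₁ (code i))
  colourAt true  i = punchIn (inject₁ (proj₁ (code i))) (proj₂ (code i))

  colour : Fin (K * K + K * K) → Fin (suc K)
  colour x = colourAt (level x) (chain x)

  colour-point : ∀ l i → colour (point l i) ≡ colourAt l i
  colour-point l i = cong₂ colourAt (level-point l i) (chain-point l i)

  colourAt-level-injective : ∀ l l′ i → colourAt l i ≡ colourAt l′ i → l ≡ l′
  colourAt-level-injective false false i _ = refl
  colourAt-level-injective true  true  i _ = refl
  colourAt-level-injective false true  i e = ⊥-elim (punchInᵢ≢i _ _ (sym e))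
  colourAt-level-injective true  false i e = ⊥-elim (punchInᵢ≢i _ _ e)

  colourAt-injective : ∀ {i j} → colourAt false i ≡ colourAt false j →
                       colourAt true i ≡ colourAt true j → i ≡ j
  colourAt-injective {i} {j} e₀ e₁ = code-injective (cong₂ _,_ p≡ q≡)
    where
    p≡ : proj₁ (code i) ≡ proj₁ (code j)
    p≡ = inject₁-injective e₀
    q≡ : proj₂ (code i) ≡ proj₂ (code j)
    q≡ = punchIn-injective _ _ _
           (trans (cong (λ p → punchIn (inject₁ p) (proj₂ (code i))) (sym p≡)) e₁)

  -- Comparable distinct points are the two ends of a chain.
  colour-proper : IsProperPosetColoring M colour
  colour-proper x y x≢y cmp e with adj⇒partner (x≢y , cmp)
  ... | c≡ , l≢ = l≢ (colourAt-level-injective (level x) (level y) (chain x)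
                        (trans e (cong (colourAt (level y)) (sym c≡))))

  bottom≼top : ∀ i → point false i ≼ point true i
  bottom≼top i = inj₂ (level-point false i , level-point true i ,
                       trans (chain-point false i) (sym (chain-point true i)))

  bottom≢top : ∀ i → point false i ≢ point true i
  bottom≢top i e = false≢true (trans (sym (level-point false i)) (trans (cong level e) (level-point true i)))

  module _ (σ : Fin (K * K + K * K) → Fin (K * K + K * K)) (aut : IsPosetAut M σ)
           (pres : ∀ x → colour (σ x) ≡ colour x) where

    fixes-chain : ∀ i → σ (point false i) ≡ point false i × σ (point true i) ≡ point true i
    fixes-chain i =
        point-ext (trans bottom (sym (level-point false i))) (trans chain≡i (sym (chain-point false i)))
      , point-ext (trans top (sym (level-point true i))) (trans (sym same) (trans chain≡i (sym (chain-point true i))))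
      where
      -- σ maps the cover of chain i to a cover, hence to some chain j ...
      covers : Covers (σ (point false i)) (σ (point true i))
      covers = strict⇒covers (bottom≢top i ∘ proj₁ (proj₁ aut)) (proj₁ (proj₂ aut) _ _ (bottom≼top i))
      bottom : level (σ (point false i)) ≡ false
      bottom = proj₁ covers
      top : level (σ (point true i)) ≡ true
      top = proj₁ (proj₂ covers)
      same : chain (σ (point false i)) ≡ chain (σ (point true i))
      same = proj₂ (proj₂ covers)
      -- ... with the same colour pair as chain i, so j = i.
      chain≡i : chain (σ (point false i)) ≡ i
      chain≡i = colourAt-injective
        (trans (cong (λ l → colourAt l (chain (σ (point false i)))) (sym bottom)) (trans (pres _) (colour-point false i)))
        (trans (cong₂ colourAt (sym top) same) (trans (pres _) (colour-point true i)))

  colour-distinguishing : IsDistinguishingPoset M colour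
  colour-distinguishing σ aut pres x =
    subst (λ z → σ z ≡ z) (point-level-chain x) (fixes (level x) (chain x))
    where
    fixes : ∀ l i → σ (point l i) ≡ point l i
    fixes false i = proj₁ (fixes-chain σ aut pres i)
    fixes true  i = proj₂ (fixes-chain σ aut pres i)

  chains-colouring : HasPDColoringPoset M (suc K)
  chains-colouring = colour , colour-proper , colour-distinguishing

xor-cancelˡ : ∀ a b → a xor (a xor b) ≡ b
xor-cancelˡ a b = trans (sym (xor-assoc a a b)) (cong (_xor b) (xor-same a))

xor-cancelʳ : ∀ a b → (a xor b) xor b ≡ a
xor-cancelʳ a b = trans (xor-assoc a b b) (trans (cong (a xor_) (xor-same b)) (xor-identityʳ a))

-- Exchanging two edges, possibly flipping both, is an automorphism, so in a
-- distinguishing colouring no two points can carry the same pair (own colour, colour of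
-- the opposite point) unless they coincide; hence n + n ≤ J * J for J colours.
module MatchingBound (n : ℕ) where
  open TwoChains n

  relabel : (Fin n → Fin n) → (Fin n → Bool) → Fin (n + n) → Fin (n + n)
  relabel π φ z = point (level z xor φ (chain z)) (π (chain z))

  level-relabel : ∀ π φ z → level (relabel π φ z) ≡ level z xor φ (chain z)
  level-relabel π φ z = level-point (level z xor φ (chain z)) (π (chain z))

  chain-relabel : ∀ π φ z → chain (relabel π φ z) ≡ π (chain z)
  chain-relabel π φ z = chain-point (level z xor φ (chain z)) (π (chain z))

  involution⇒bijective : ∀ (σ : Fin (n + n) → Fin (n + n)) → (∀ z → σ (σ z) ≡ z) → Bijective _≡_ _≡_ σ
  involution⇒bijective σ inv =
      (λ {x} {y} e → trans (sym (inv x)) (trans (cong σ e) (inv y)))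
    , (λ y → σ y , λ { refl → inv y })

  module _ {π : Fin n → Fin n} {φ : Fin n → Bool}
           (π-involutive : ∀ m → π (π m) ≡ m) (φ-invariant : ∀ m → φ (π m) ≡ φ m) where

    relabel-involutive : ∀ z → relabel π φ (relabel π φ z) ≡ z
    relabel-involutive z = point-ext level≡ chain≡
      where
      open ≡-Reasoning
      level≡ : level (relabel π φ (relabel π φ z)) ≡ level z
      level≡ = begin
        level (relabel π φ (relabel π φ z))                 ≡⟨ level-relabel π φ _ ⟩
        level (relabel π φ z) xor φ (chain (relabel π φ z)) ≡⟨ cong₂ _xor_ (level-relabel π φ z) (cong φ (chain-relabel π φ z)) ⟩
        (level z xor φ (chain z)) xor φ (π (chain z))       ≡⟨ cong ((level z xor φ (chain z)) xor_) (φ-invariant (chain z)) ⟩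
        (level z xor φ (chain z)) xor φ (chain z)           ≡⟨ xor-cancelʳ (level z) (φ (chain z)) ⟩
        level z                                             ∎
      chain≡ : chain (relabel π φ (relabel π φ z)) ≡ chain z
      chain≡ = trans (chain-relabel π φ _) (trans (cong π (chain-relabel π φ z)) (π-involutive (chain z)))

    relabel-partner : ∀ {z w} → Partner z w → Partner (relabel π φ z) (relabel π φ w)
    relabel-partner {z} {w} (c≡ , l≢) =
        trans (chain-relabel π φ z) (trans (cong π c≡) (sym (chain-relabel π φ w)))
      , λ l≡ → l≢ (trans (sym (xor-cancelʳ (level z) (φ (chain z))))
                  (trans (cong (_xor φ (chain z)) (flipped-levels l≡))
                         (xor-cancelʳ (level w) (φ (chain z)))))
      where
      flipped-levels : level (relabel π φ z) ≡ level (relabel π φ w) →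
                       level z xor φ (chain z) ≡ level w xor φ (chain z)
      flipped-levels l≡ = trans (sym (level-relabel π φ z))
                           (trans l≡ (trans (level-relabel π φ w) (cong (λ m → level w xor φ m) (sym c≡))))

    relabel-aut : IsGraphAut G (relabel π φ)
    relabel-aut = involution⇒bijective σ relabel-involutive
                , (λ x y → partner⇒adj ∘ relabel-partner ∘ adj⇒partner)
                , (λ x y → subst₂ (FinGraph.Adj G) (relabel-involutive x) (relabel-involutive y)
                           ∘ partner⇒adj ∘ relabel-partner ∘ adj⇒partner)
      where
      σ : Fin (n + n) → Fin (n + n)
      σ = relabel π φ

  module Exchange (i k : Fin n) (i≢k : i ≢ k) (b : Bool) where

    data Position (m : Fin n) : Set where
      at-i  : m ≡ i → Position m
      at-k  : m ≡ k → Position m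
      other : m ≢ i → m ≢ k → Position m

    position : ∀ m → Position m
    position m with m ≟ i | m ≟ k
    ... | yes m≡i | _       = at-i m≡i
    ... | no  _   | yes m≡k = at-k m≡k
    ... | no  m≢i | no  m≢k = other m≢i m≢k

    π : Fin n → Fin n
    π m with position m
    ... | at-i _    = k
    ... | at-k _    = i
    ... | other _ _ = m

    φ : Fin n → Bool
    φ m with position m
    ... | at-i _    = b
    ... | at-k _    = b
    ... | other _ _ = false

    at-i-spec : ∀ {m} → m ≡ i → π m ≡ k × φ m ≡ b
    at-i-spec {m} m≡i with position m
    ... | at-i _      = refl , refl
    ... | at-k m≡k    = ⊥-elim (i≢k (trans (sym m≡i) m≡k))
    ... | other m≢i _ = ⊥-elim (m≢i m≡i)

    at-k-spec : ∀ {m} → m ≡ k → π m ≡ i × φ m ≡ b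
    at-k-spec {m} m≡k with position m
    ... | at-i m≡i    = ⊥-elim (i≢k (trans (sym m≡i) m≡k))
    ... | at-k _      = refl , refl
    ... | other _ m≢k = ⊥-elim (m≢k m≡k)

    other-spec : ∀ {m} → m ≢ i → m ≢ k → π m ≡ m × φ m ≡ false
    other-spec {m} m≢i m≢k with position m
    ... | at-i m≡i  = ⊥-elim (m≢i m≡i)
    ... | at-k m≡k  = ⊥-elim (m≢k m≡k)
    ... | other _ _ = refl , refl

    π-involutive : ∀ m → π (π m) ≡ m
    π-involutive m with position m
    ... | at-i m≡i      = trans (proj₁ (at-k-spec refl)) (sym m≡i)
    ... | at-k m≡k      = trans (proj₁ (at-i-spec refl)) (sym m≡k)
    ... | other m≢i m≢k = proj₁ (other-spec m≢i m≢k)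

    φ-invariant : ∀ m → φ (π m) ≡ φ m
    φ-invariant m with position m
    ... | at-i _        = proj₂ (at-k-spec refl)
    ... | at-k _        = proj₂ (at-i-spec refl)
    ... | other m≢i m≢k = proj₂ (other-spec m≢i m≢k)

  module _ {J : ℕ} (c : Fin (n + n) → Fin J)
           (proper : IsProperGraphColoring G c) (distinguishing : IsDistinguishingGraph G c) where

    transfer : ∀ x y → c x ≡ c y → c (opposite x) ≡ c (opposite y) →
               ∀ t → c (point (t xor (level x xor level y)) (chain y)) ≡ c (point t (chain x))
    transfer x y e e′ t with t ≟ᵇ level x
    ... | yes refl = begin
      c (point (level x xor (level x xor level y)) (chain y)) ≡⟨ cong (λ l → c (point l (chain y))) (xor-cancelˡ (level x) (level y)) ⟩
      c (point (level y) (chain y))                           ≡⟨ cong c (point-level-chain y) ⟩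
      c y                                                     ≡⟨ sym e ⟩
      c x                                                     ≡⟨ cong c (sym (point-level-chain x)) ⟩
      c (point (level x) (chain x))                           ∎
      where open ≡-Reasoning
    ... | no t≢lx rewrite ¬-not t≢lx = begin
      c (point (not (level x) xor (level x xor level y)) (chain y)) ≡⟨ cong (λ l → c (point l (chain y))) not-cancel ⟩
      c (opposite y)                                                ≡⟨ sym e′ ⟩
      c (opposite x)                                                ∎
      where
      open ≡-Reasoning
      not-cancel : not (level x) xor (level x xor level y) ≡ not (level y)
      not-cancel = trans (sym (not-distribˡ-xor (level x) _)) (cong not (xor-cancelˡ (level x) (level y)))

    -- Two points with the same colour pair lie on the same chain: otherwise exchanging
    -- their chains is a colour-preserving automorphism moving x.
    same-pair⇒same-chain : ∀ x y → c x ≡ c y → c (opposite x) ≡ c (opposite y) → chain x ≡ chain y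
    same-pair⇒same-chain x y e e′ with chain x ≟ chain y
    ... | yes c≡ = c≡
    ... | no  c≢ = ⊥-elim (c≢ (trans (sym (cong chain (σ-fixes x))) moved))
      where
      open Exchange (chain x) (chain y) c≢ (level x xor level y)
      σ : Fin (n + n) → Fin (n + n)
      σ = relabel π φ

      relabel-by : ∀ z {m f} → π (chain z) ≡ m × φ (chain z) ≡ f → σ z ≡ point (level z xor f) m
      relabel-by z (π≡ , φ≡) = cong₂ point (cong (level z xor_) φ≡) π≡

      preserves-at : ∀ z → Position (chain z) → c (σ z) ≡ c z
      preserves-at z (at-i z∈x) = trans (cong c (relabel-by z (at-i-spec z∈x)))
                       (trans (transfer x y e e′ (level z))
                              (cong c (trans (cong (point (level z)) (sym z∈x)) (point-level-chain z))))
      preserves-at z (at-k z∈y) = trans (cong c (trans (relabel-by z (at-k-spec z∈y))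
                                          (cong (λ f → point (level z xor f) (chain x)) (xor-comm (level x) (level y)))))
                       (trans (transfer y x (sym e) (sym e′) (level z))
                              (cong c (trans (cong (point (level z)) (sym z∈y)) (point-level-chain z))))
      preserves-at z (other z∉x z∉y) = cong c (trans (relabel-by z (other-spec z∉x z∉y))
                                       (trans (cong (λ l → point l (chain z)) (xor-identityʳ (level z)))
                                              (point-level-chain z)))

      σ-fixes : ∀ z → σ z ≡ z
      σ-fixes = distinguishing σ (relabel-aut π-involutive φ-invariant)
                               (λ z → preserves-at z (position (chain z)))

      moved : chain (σ x) ≡ chain y
      moved = trans (chain-relabel π φ x) (proj₁ (at-i-spec refl))

    pair : Fin (n + n) → Fin (J * J)
    pair x = combine (c x) (c (opposite x))

    -- Equal pairs on different levels would be adjacent points with equal colours.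
    pair-injective : Injective _≡_ _≡_ pair
    pair-injective {x} {y} e = by-levels (level x ≟ᵇ level y)
      where
      colours≡ : c x ≡ c y × c (opposite x) ≡ c (opposite y)
      colours≡ = combine-injective (c x) (c (opposite x)) (c y) (c (opposite y)) e
      same-chain : chain x ≡ chain y
      same-chain = same-pair⇒same-chain x y (proj₁ colours≡) (proj₂ colours≡)
      by-levels : Dec (level x ≡ level y) → x ≡ y
      by-levels (yes l≡) = point-ext l≡ same-chain
      by-levels (no  l≢) = ⊥-elim (proper x y (partner⇒adj (same-chain , l≢)) (proj₁ colours≡))

    colours-bound : n + n ≤ J * J
    colours-bound = injective⇒≤ pair-injective

-- With K = 3N: if 2 (3N)² ≤ b², then b > 4N, i.e. (3N + 1) + N ≤ b, since (4N)² < 18 N².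
square-gap : ∀ N b → 1 ≤ N → 3 * N * (3 * N) + 3 * N * (3 * N) ≤ b * b → suc (3 * N) + N ≤ b
square-gap N b N≥1 bound = ≮⇒≥ λ { (s≤s b≤4N) → <-irrefl refl (≤-<-trans bound (too-small b≤4N)) }
  where
  open ≤-Reasoning
  open +-*-Solver
  identity : (3 * N + N) * (3 * N + N) + (N * N + N * N) ≡ 3 * N * (3 * N) + 3 * N * (3 * N)
  identity = solve 1 (λ m → (con 3 :* m :+ m) :* (con 3 :* m :+ m) :+ (m :* m :+ m :* m)
                         := con 3 :* m :* (con 3 :* m) :+ con 3 :* m :* (con 3 :* m)) refl N
  positive : 0 < N * N + N * N
  positive = ≤-trans (*-mono-≤ N≥1 N≥1) (m≤m+n (N * N) (N * N))
  too-small : b ≤ 3 * N + N → b * b < 3 * N * (3 * N) + 3 * N * (3 * N)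
  too-small b≤4N = begin-strict
    b * b                                             ≤⟨ *-mono-≤ b≤4N b≤4N ⟩
    (3 * N + N) * (3 * N + N)                         <⟨ m<m+n _ positive ⟩
    (3 * N + N) * (3 * N + N) + (N * N + N * N)       ≡⟨ identity ⟩
    3 * N * (3 * N) + 3 * N * (3 * N)                 ∎

proposition4p3 : (N : ℕ) → 1 ≤ N →
    Σ FinPoset λ P → Σ ℕ λ a → Σ ℕ λ b →
    IsChiDPoset P a × IsChiDGraph (comparabilityGraph P) b × a + N ≤ b
proposition4p3 N N≥1 = M , a , b , χ-M , χ-G , gap
  where
  K : ℕ
  K = 3 * N
  open TwoChains (K * K)
  open ChainColouring K using (chains-colouring)

  a : ℕ
  a = proj₁ (chiD-poset M _≼?_ (suc K) chains-colouring)
  χ-M : IsChiDPoset M a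
  χ-M = proj₂ (chiD-poset M _≼?_ (suc K) chains-colouring)
  a≤K+1 : a ≤ suc K
  a≤K+1 = proj₂ χ-M (suc K) chains-colouring

  b : ℕ
  b = proj₁ (chiD-comparability M _≼?_)
  χ-G : IsChiDGraph G b
  χ-G = proj₂ (chiD-comparability M _≼?_)
  optimal : HasPDColoringGraph G b
  optimal = proj₁ χ-G
  2K²≤b² : K * K + K * K ≤ b * b
  2K²≤b² = MatchingBound.colours-bound (K * K) (proj₁ optimal) (proj₁ (proj₂ optimal)) (proj₂ (proj₂ optimal))

  gap : a + N ≤ b
  gap = ≤-trans (+-monoˡ-≤ N a≤K+1) (square-gap N b N≥1 2K²≤b²)
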